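{- Let $n\ge 2$, $k\ge 1$, $t\ge1$ be integers and let $r$ be a simplicial vertex of $P_n^{(k)}$. Then $\pi_t(P_n^{(k)},r)\ge p_t(n,k)$.
   Context: $P_n^{(k)}$ has vertices $v_1,\dots,v_n$ with $v_i\sim v_j$ iff $1\le|i-j|\le k$; a vertex is simplicial if its neighborhood induces a complete graph. For $n\ge2$: $d=\lfloor (n-2)/k\rfloor+1$, $b=(n-2)-k(d-1)$, $p_t(n,k)=\max\{t2^d+b,\ 2t+n-2\}$. A pebbling step from a vertex with at least two pebbles to a neighbor removes two pebbles there and adds one to the neighbor; $\pi_t(G,r)$ is the least $m$ such that every configuration of $m$ pebbles on $G$ admits a sequence of pebbling steps placing at least $t$ pebbles on $r$. -}

module Defs where

open import Data.Nat using (ℕ; _+_; _*_; _∸_; _^_; _≤_; _⊔_; ∣_-_∣; NonZero)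
open import Data.Nat.DivMod using (_/_)
open import Data.Fin using (Fin; toℕ; _≟_)
open import Data.List using (map; allFin)
open import Data.Nat.ListAction using (sum)
open import Data.Product using (Σ; _×_; ∃)
open import Relation.Nullary using (¬_; yes; no)
open import Relation.Binary.PropositionalEquality using (_≡_)
open import Relation.Binary.Construct.Closure.ReflexiveTransitive using (Star)

-- Vertices of P_n^(k) are Fin n; vertex i stands for v_(i+1).
-- Adjacency in P_n^(k): 1 ≤ |i - j| ≤ k.
Adj : (n k : ℕ) → Fin n → Fin n → Set
Adj n k i j = (1 ≤ ∣ toℕ i - toℕ j ∣) × (∣ toℕ i - toℕ j ∣ ≤ k)

Simplicial : (n k : ℕ) → Fin n → Set
Simplicial n k r = ∀ u w → Adj n k r u → Adj n k r w → ¬ (u ≡ w) → Adj n k u w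

Config : ℕ → Set
Config n = Fin n → ℕ

size : {n : ℕ} → Config n → ℕ
size {n} C = sum (map C (allFin n))

move : {n : ℕ} → Config n → Fin n → Fin n → Config n
move C u w x with x ≟ u
... | yes _ = C x ∸ 2
... | no _ with x ≟ w
...   | yes _ = C x + 1
...   | no _ = C x

data Step (n k : ℕ) (C : Config n) : Config n → Set where
  step : (u w : Fin n) → Adj n k u w → 2 ≤ C u → Step n k C (move C u w)

Solvable : (n k t : ℕ) → Fin n → Config n → Set
Solvable n k t r C = ∃ λ C' → Star (Step n k) C C' × (t ≤ C' r)

dd : (n k : ℕ) → .{{_ : NonZero k}} → ℕ
dd n k = (n ∸ 2) / k + 1

bb : (n k : ℕ) → .{{_ : NonZero k}} → ℕ
bb n k = (n ∸ 2) ∸ k * (dd n k ∸ 1)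

pt : (n k t : ℕ) → .{{_ : NonZero k}} → ℕ
pt n k t = (t * 2 ^ dd n k + bb n k) ⊔ (2 * t + n ∸ 2)

-- Put vertex x at level ℓ(x) = ⌈|x − r|/k⌉, so a pebbling step lowers the level by at most one.
-- For a depth e ≥ 1 let c pebbles on x weigh 2^(e−ℓ(x))·c when ℓ(x) < e and 2⌊c/2⌋ when x is
-- far (ℓ(x) ≥ e): a pebble moved one level closer to r is worth at most the two it cost, and
-- a lone far pebble can never move. So no step increases the total weight, while t pebbles
-- on r weigh 2^e·t. One pebble on each far vertex plus 2^e·t − 2 more on one of them weighs
-- only 2^e·t − 1, hence is unsolvable. For e = 1 all n − 1 vertices other than r are far,
-- giving 2t + n − 2. A simplicial r is an end of the path unless n − 1 ≤ k (so d = 1 and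
-- b = n − 2); either way depth e = d leaves b + 1 far vertices, giving t·2^d + b.
module Submission where

open import Defs
open import Data.Nat using (ℕ; zero; suc; NonZero; _+_; _*_; _∸_; _^_; _≤_; _<_; _⊓_; ∣_-_∣; z≤n; s≤s; z<s; s≤s⁻¹)
open import Data.Nat.Properties renaming (_≟_ to _≟ℕ_)
open import Data.Nat.DivMod using (_/_; /-monoˡ-≤; m*n/n≡m; m/n*n≤m; m<n⇒m/n≡0; m/n≡1+[m∸n]/n)
open import Data.Nat.Tactic.RingSolver using (solve-∀)
open import Data.Fin using (Fin; zero; suc; toℕ; fromℕ<; _≟_)
open import Data.Fin.Properties using (punchInᵢ≢i; toℕ-fromℕ<; toℕ<n; toℕ-injective)
open import Data.Vec.Functional using (Vector; removeAt; updateAt)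
open import Data.Vec.Functional.Properties using (updateAt-updates; updateAt-minimal)
open import Data.List using (tabulate)
open import Data.List.Properties using (map-tabulate)
import Data.Nat.ListAction as List
open import Algebra.Properties.CommutativeMonoid.Sum +-0-commutativeMonoid
  using (sum-remove; sum-cong-≗; sum-replicate-zero) renaming (sum to ∑)
open import Algebra.Properties.CommutativeSemigroup +-commutativeSemigroup using (interchange)
open import Data.Product using (Σ; _×_; _,_; proj₁; proj₂; ∃)
open import Data.Sum using (_⊎_; inj₁; inj₂)
open import Data.Empty using (⊥; ⊥-elim)
open import Function using (id; _∘_)
open import Relation.Nullary using (¬_; yes; no)
open import Relation.Binary.PropositionalEquality
open import Relation.Binary.Construct.Closure.ReflexiveTransitive using (Star; fold)

size≡∑ : ∀ {n} (C : Config n) → size C ≡ ∑ C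
size≡∑ C = trans (cong List.sum (map-tabulate id C)) (sum-tabulate C)
  where
  sum-tabulate : ∀ {n} (f : Vector ℕ n) → List.sum (tabulate f) ≡ ∑ f
  sum-tabulate {zero}  f = refl
  sum-tabulate {suc n} f = cong (f zero +_) (sum-tabulate (f ∘ suc))

∑-mono-≤ : ∀ {n} {f g : Vector ℕ n} → (∀ x → f x ≤ g x) → ∑ f ≤ ∑ g
∑-mono-≤ {zero}  f≤g = z≤n
∑-mono-≤ {suc n} f≤g = +-mono-≤ (f≤g zero) (∑-mono-≤ (f≤g ∘ suc))

∑-distrib-+ : ∀ {n} (f g : Vector ℕ n) → ∑ (λ x → f x + g x) ≡ ∑ f + ∑ g
∑-distrib-+ {zero}  f g = refl
∑-distrib-+ {suc n} f g =
  trans (cong (f zero + g zero +_) (∑-distrib-+ (f ∘ suc) (g ∘ suc)))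
        (interchange (f zero) (g zero) _ _)

≤∑ : ∀ {n} (f : Vector ℕ n) x → f x ≤ ∑ f
≤∑ {suc n} f x = ≤-trans (m≤m+n (f x) _) (≤-reflexive (sym (sum-remove {i = x} f)))

∑-single : ∀ {n} (f : Vector ℕ n) u → (∀ x → x ≢ u → f x ≡ 0) → ∑ f ≡ f u
∑-single {suc n} f u off = begin
  ∑ f                      ≡⟨ sum-remove {i = u} f ⟩
  f u + ∑ (removeAt f u)   ≡⟨ cong (f u +_) (sum-cong-≗ (λ x → off _ (punchInᵢ≢i u x))) ⟩
  f u + ∑ {n} (λ _ → 0)    ≡⟨ cong (f u +_) (sum-replicate-zero n) ⟩
  f u + 0                  ≡⟨ +-identityʳ (f u) ⟩
  f u                      ∎
  where open ≡-Reasoning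

∑-exchange : ∀ {n} (f g : Vector ℕ n) u → (∀ x → x ≢ u → f x ≡ g x) → ∑ f + g u ≡ ∑ g + f u
∑-exchange {suc n} f g u agree = begin
  ∑ f + g u                      ≡⟨ cong (_+ g u) (sum-remove {i = u} f) ⟩
  f u + ∑ (removeAt f u) + g u   ≡⟨ cong (λ s → f u + s + g u) (sum-cong-≗ (λ x → agree _ (punchInᵢ≢i u x))) ⟩
  f u + ∑ (removeAt g u) + g u   ≡⟨ swap-ends (f u) _ (g u) ⟩
  g u + ∑ (removeAt g u) + f u   ≡⟨ cong (_+ f u) (sum-remove {i = u} g) ⟨
  ∑ g + f u                      ∎
  where
  open ≡-Reasoning
  swap-ends : ∀ a s b → a + s + b ≡ b + s + a
  swap-ends = solve-∀

∑-exchange-two : ∀ {n} (f g : Vector ℕ n) u w → u ≢ w → (∀ x → x ≢ u → x ≢ w → f x ≡ g x)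
               → g u + g w ≤ f u + f w → ∑ g ≤ ∑ f
∑-exchange-two f g u w u≢w agree gain≤loss = +-cancelʳ-≤ (f u + f w) (∑ g) (∑ f) (begin
  ∑ g + (f u + f w)   ≡⟨ shuffle (∑ g) (f u) (f w) ⟩
  ∑ g + f w + f u     ≡⟨ cong (λ a → ∑ g + a + f u) (updateAt-minimal w u f (u≢w ∘ sym)) ⟨
  ∑ g + h w + f u     ≡⟨ cong (_+ f u) (∑-exchange h g w h≡g) ⟨
  ∑ h + g w + f u     ≡⟨ shuffle′ (∑ h) (g w) (f u) ⟩
  ∑ h + f u + g w     ≡⟨ cong (_+ g w) (∑-exchange f h u f≡h) ⟨
  ∑ f + h u + g w     ≡⟨ cong (λ a → ∑ f + a + g w) (updateAt-updates u f) ⟩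
  ∑ f + g u + g w     ≡⟨ +-assoc (∑ f) (g u) (g w) ⟩
  ∑ f + (g u + g w)   ≤⟨ +-monoʳ-≤ (∑ f) gain≤loss ⟩
  ∑ f + (f u + f w)   ∎)
  where
  open ≤-Reasoning
  h : Vector ℕ _
  h = updateAt f u (λ _ → g u)
  f≡h : ∀ x → x ≢ u → f x ≡ h x
  f≡h x x≢u = sym (updateAt-minimal x u f x≢u)
  h≡g : ∀ x → x ≢ w → h x ≡ g x
  h≡g x x≢w with x ≟ u
  ... | yes refl = updateAt-updates u f
  ... | no x≢u   = trans (updateAt-minimal x u f x≢u) (agree x x≢u x≢w)
  shuffle : ∀ s a b → s + (a + b) ≡ s + b + a
  shuffle = solve-∀
  shuffle′ : ∀ s a b → s + a + b ≡ s + b + a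
  shuffle′ = solve-∀

∑-shrink : ∀ {n} (f : Vector ℕ n) m → m ≤ ∑ f → Σ (Vector ℕ n) λ g → (∀ x → g x ≤ f x) × ∑ g ≡ m
∑-shrink {zero} f m m≤0 = (λ ()) , (λ ()) , sym (n≤0⇒n≡0 m≤0)
∑-shrink {suc n} f m m≤∑f with ∑-shrink (f ∘ suc) (m ∸ f zero) (m≤n+o⇒m∸n≤o m (f zero) m≤∑f)
... | g , g≤f , ∑g≡ = g′ , g′≤f , trans (cong (f zero ⊓ m +_) ∑g≡) (m⊓n+n∸m≡n (f zero) m)
  where
  g′ : Vector ℕ (suc n)
  g′ zero    = f zero ⊓ m
  g′ (suc x) = g x
  g′≤f : ∀ x → g′ x ≤ f x
  g′≤f zero    = m⊓n≤m (f zero) m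
  g′≤f (suc x) = g≤f x

∑-≥-range : ∀ {n} (f : Vector ℕ n) lo hi → hi ≤ n
          → (∀ x → lo ≤ toℕ x → toℕ x < hi → 1 ≤ f x) → hi ∸ lo ≤ ∑ f
∑-≥-range f lo zero _ _ = ≤-trans (≤-reflexive (0∸n≡0 lo)) z≤n
∑-≥-range {suc n} f zero (suc hi) (s≤s hi≤n) pos =
  +-mono-≤ (pos zero z≤n z<s) (∑-≥-range (f ∘ suc) zero hi hi≤n (λ x _ x<hi → pos (suc x) z≤n (s≤s x<hi)))
∑-≥-range {suc n} f (suc lo) (suc hi) (s≤s hi≤n) pos =
  ≤-trans (∑-≥-range (f ∘ suc) lo hi hi≤n (λ x lo≤x x<hi → pos (suc x) (s≤s lo≤x) (s≤s x<hi)))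
          (m≤n+m _ (f zero))

∑-≥-allBut : ∀ {n} (f : Vector ℕ n) u → (∀ x → x ≢ u → 1 ≤ f x) → n ∸ 1 ≤ ∑ f
∑-≥-allBut {suc n} f u pos = begin
  n                         ≤⟨ ∑-≥-range (removeAt f u) 0 n ≤-refl (λ x _ _ → pos _ (punchInᵢ≢i u x)) ⟩
  ∑ (removeAt f u)          ≤⟨ m≤n+m _ (f u) ⟩
  f u + ∑ (removeAt f u)    ≡⟨ sum-remove {i = u} f ⟨
  ∑ f                       ∎
  where open ≤-Reasoning

∑-pos⇒∃-pos : ∀ {n} (f : Vector ℕ n) → 0 < ∑ f → ∃ λ x → 0 < f x
∑-pos⇒∃-pos {suc n} f 0<∑ with f zero in f₀≡
... | suc _ = zero , subst (0 <_) (sym f₀≡) z<s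
... | zero with ∑-pos⇒∃-pos (f ∘ suc) 0<∑
...   | x , 0<fx = suc x , 0<fx

move-source : ∀ {n} (C : Config n) u w → move C u w u ≡ C u ∸ 2
move-source C u w with u ≟ u
... | yes _  = refl
... | no u≢u = ⊥-elim (u≢u refl)

move-target : ∀ {n} (C : Config n) u w → u ≢ w → move C u w w ≡ C w + 1
move-target C u w u≢w with w ≟ u
... | yes w≡u = ⊥-elim (u≢w (sym w≡u))
... | no _ with w ≟ w
...   | yes _  = refl
...   | no w≢w = ⊥-elim (w≢w refl)

move-other : ∀ {n} (C : Config n) u w x → x ≢ u → x ≢ w → move C u w x ≡ C x
move-other C u w x x≢u x≢w with x ≟ u
... | yes x≡u = ⊥-elim (x≢u x≡u)
... | no _ with x ≟ w
...   | yes x≡w = ⊥-elim (x≢w x≡w)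
...   | no _    = refl

Adj⇒≢ : ∀ {n k} {u w : Fin n} → Adj n k u w → u ≢ w
Adj⇒≢ {u = u} (1≤∣u-w∣ , _) refl = <⇒≢ 1≤∣u-w∣ (sym (∣n-n∣≡0 (toℕ u)))

≢⇒0<∣-∣ : ∀ {n} {u w : Fin n} → u ≢ w → 0 < ∣ toℕ u - toℕ w ∣
≢⇒0<∣-∣ u≢w = n≢0⇒n>0 (u≢w ∘ toℕ-injective ∘ ∣m-n∣≡0⇒m≡n)

evenFloor : ℕ → ℕ
evenFloor zero          = zero
evenFloor (suc zero)    = zero
evenFloor (suc (suc c)) = suc (suc (evenFloor c))

evenFloor-≤ : ∀ c → evenFloor c ≤ c
evenFloor-≤ zero          = z≤n
evenFloor-≤ (suc zero)    = z≤n
evenFloor-≤ (suc (suc c)) = s≤s (s≤s (evenFloor-≤ c))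

evenFloor-mono-≤ : ∀ {a b} → a ≤ b → evenFloor a ≤ evenFloor b
evenFloor-mono-≤ {zero}        _                 = z≤n
evenFloor-mono-≤ {suc zero}    _                 = z≤n
evenFloor-mono-≤ {suc (suc a)} (s≤s (s≤s a≤b)) = s≤s (s≤s (evenFloor-mono-≤ a≤b))

evenFloor-suc : ∀ c → evenFloor (suc c) ≤ 2 + evenFloor c
evenFloor-suc zero          = z≤n
evenFloor-suc (suc zero)    = ≤-refl
evenFloor-suc (suc (suc c)) = s≤s (s≤s (evenFloor-suc c))

⌈_/suc_⌉ : ℕ → ℕ → ℕ
⌈ d /suc k′ ⌉ = (d + k′) / suc k′

⌈0/⌉≡0 : ∀ k′ → ⌈ 0 /suc k′ ⌉ ≡ 0
⌈0/⌉≡0 k′ = m<n⇒m/n≡0 (n<1+n k′)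

⌈/⌉-mono-≤ : ∀ k′ {d d′} → d ≤ d′ → ⌈ d /suc k′ ⌉ ≤ ⌈ d′ /suc k′ ⌉
⌈/⌉-mono-≤ k′ d≤d′ = /-monoˡ-≤ (suc k′) (+-monoˡ-≤ k′ d≤d′)

⌈1+k+d/⌉≡1+⌈d/⌉ : ∀ k′ d → ⌈ suc k′ + d /suc k′ ⌉ ≡ suc ⌈ d /suc k′ ⌉
⌈1+k+d/⌉≡1+⌈d/⌉ k′ d = begin
  (suc k′ + d + k′) / suc k′                       ≡⟨ cong (_/ suc k′) (+-assoc (suc k′) d k′) ⟩
  (suc k′ + (d + k′)) / suc k′                     ≡⟨ m/n≡1+[m∸n]/n (m≤m+n (suc k′) _) ⟩
  suc ((suc k′ + (d + k′) ∸ suc k′) / suc k′)      ≡⟨ cong (λ x → suc (x / suc k′)) (m+n∸m≡n (suc k′) _) ⟩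
  suc ((d + k′) / suc k′)                          ∎
  where open ≡-Reasoning

<⌈/⌉ : ∀ k′ q {d} → q * suc k′ < d → q < ⌈ d /suc k′ ⌉
<⌈/⌉ k′ q {d} qk<d = begin
  suc q                        ≡⟨ m*n/n≡m (suc q) (suc k′) ⟨
  suc q * suc k′ / suc k′      ≤⟨ /-monoˡ-≤ (suc k′) (≤-trans (≤-reflexive (split q k′)) (+-monoˡ-≤ k′ qk<d)) ⟩
  (d + k′) / suc k′            ∎
  where
  open ≤-Reasoning
  split : ∀ q k′ → suc q * suc k′ ≡ suc (q * suc k′) + k′
  split = solve-∀

module Potential (k′ : ℕ) {n : ℕ} (r : Fin n) (e : ℕ) where

  level : Fin n → ℕ
  level x = ⌈ ∣ toℕ x - toℕ r ∣ /suc k′ ⌉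

  level-root : level r ≡ 0
  level-root rewrite ∣n-n∣≡0 (toℕ r) = ⌈0/⌉≡0 k′

  level-adj : ∀ {u w} → Adj n (suc k′) u w → level u ≤ suc (level w)
  level-adj {u} {w} (_ , ∣u-w∣≤k) = begin
    level u                                           ≤⟨ ⌈/⌉-mono-≤ k′ (∣-∣-triangle (toℕ u) (toℕ w) (toℕ r)) ⟩
    ⌈ ∣ toℕ u - toℕ w ∣ + ∣ toℕ w - toℕ r ∣ /suc k′ ⌉  ≤⟨ ⌈/⌉-mono-≤ k′ (+-monoˡ-≤ _ ∣u-w∣≤k) ⟩
    ⌈ suc k′ + ∣ toℕ w - toℕ r ∣ /suc k′ ⌉             ≡⟨ ⌈1+k+d/⌉≡1+⌈d/⌉ k′ _ ⟩
    suc (level w)                                     ∎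
    where open ≤-Reasoning

  weight : ℕ → ℕ → ℕ
  weight L c with e ≤? L
  ... | yes _ = evenFloor c
  ... | no _  = 2 ^ (e ∸ L) * c

  weight-mono-≤ : ∀ L {a b} → a ≤ b → weight L a ≤ weight L b
  weight-mono-≤ L a≤b with e ≤? L
  ... | yes _ = evenFloor-mono-≤ a≤b
  ... | no _  = *-monoʳ-≤ (2 ^ (e ∸ L)) a≤b

  -- At far levels e ∸ L is 0, so 2 ^ (e ∸ L) = 1 and both regimes obey the same bounds.
  weight-+2 : ∀ L a → weight L (2 + a) ≡ 2 * 2 ^ (e ∸ L) + weight L a
  weight-+2 L a with e ≤? L
  ... | yes e≤L rewrite m≤n⇒m∸n≡0 e≤L = refl
  ... | no _    = distrib (2 ^ (e ∸ L)) a
    where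
    distrib : ∀ p a → p * (2 + a) ≡ 2 * p + p * a
    distrib = solve-∀

  weight-+1 : ∀ L c → weight L (1 + c) ≤ 2 * 2 ^ (e ∸ suc L) + weight L c
  weight-+1 L c with e ≤? L
  ... | yes e≤L rewrite m≤n⇒m∸n≡0 (m≤n⇒m≤1+n e≤L) = evenFloor-suc c
  ... | no e≰L  rewrite +-∸-assoc 1 (≰⇒> e≰L) = ≤-reflexive (distrib (2 ^ suc (e ∸ suc L)) c)
    where
    distrib : ∀ p c → p * (1 + c) ≡ p + p * c
    distrib = solve-∀

  weight-step : ∀ {Lu Lw} → Lu ≤ suc Lw → ∀ a c
              → weight Lu a + weight Lw (1 + c) ≤ weight Lu (2 + a) + weight Lw c
  weight-step {Lu} {Lw} Lu≤1+Lw a c = begin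
    weight Lu a + weight Lw (1 + c)                 ≤⟨ +-monoʳ-≤ (weight Lu a) (weight-+1 Lw c) ⟩
    weight Lu a + (2 * 2 ^ (e ∸ suc Lw) + weight Lw c)
      ≤⟨ +-monoʳ-≤ (weight Lu a) (+-monoˡ-≤ (weight Lw c) (*-monoʳ-≤ 2 (^-monoʳ-≤ 2 (∸-monoʳ-≤ e Lu≤1+Lw)))) ⟩
    weight Lu a + (2 * 2 ^ (e ∸ Lu) + weight Lw c)  ≡⟨ shuffle (weight Lu a) (2 * 2 ^ (e ∸ Lu)) (weight Lw c) ⟩
    2 * 2 ^ (e ∸ Lu) + weight Lu a + weight Lw c    ≡⟨ cong (_+ weight Lw c) (weight-+2 Lu a) ⟨
    weight Lu (2 + a) + weight Lw c                 ∎
    where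
    open ≤-Reasoning
    shuffle : ∀ x y z → x + (y + z) ≡ y + x + z
    shuffle = solve-∀

  weight-root : 0 < e → ∀ c → weight 0 c ≡ 2 ^ e * c
  weight-root 0<e c with e ≤? 0
  ... | yes e≤0 = ⊥-elim (<⇒≱ 0<e e≤0)
  ... | no _    = refl

  Φ : Config n → ℕ
  Φ C = ∑ λ x → weight (level x) (C x)

  Φ-mono-≤ : ∀ {C D : Config n} → (∀ x → C x ≤ D x) → Φ C ≤ Φ D
  Φ-mono-≤ C≤D = ∑-mono-≤ λ x → weight-mono-≤ (level x) (C≤D x)

  Φ-step : ∀ {C C′} → Step n (suc k′) C C′ → Φ C′ ≤ Φ C
  Φ-step {C} (step u w u~w 2≤Cu) =
    ∑-exchange-two (λ x → weight (level x) (C x)) (λ x → weight (level x) (move C u w x)) u w u≢w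
      (λ x x≢u x≢w → cong (weight (level x)) (sym (move-other C u w x x≢u x≢w)))
      (begin
        weight (level u) (move C u w u) + weight (level w) (move C u w w)
          ≡⟨ cong₂ (λ a c → weight (level u) a + weight (level w) c)
                   (move-source C u w) (trans (move-target C u w u≢w) (+-comm (C w) 1)) ⟩
        weight (level u) (C u ∸ 2) + weight (level w) (1 + C w)
          ≤⟨ weight-step (level-adj {u} {w} u~w) (C u ∸ 2) (C w) ⟩
        weight (level u) (2 + (C u ∸ 2)) + weight (level w) (C w)
          ≡⟨ cong (λ a → weight (level u) a + weight (level w) (C w)) (m+[n∸m]≡n 2≤Cu) ⟩
        weight (level u) (C u) + weight (level w) (C w)  ∎)
    where
    open ≤-Reasoning
    u≢w = Adj⇒≢ u~w

  Φ-star : ∀ {C C′} → Star (Step n (suc k′)) C C′ → Φ C′ ≤ Φ C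
  Φ-star = fold (λ C C′ → Φ C′ ≤ Φ C) (λ s ≤Φ → ≤-trans ≤Φ (Φ-step s)) ≤-refl

  Solvable⇒Φ-≥ : ∀ {t C} → 0 < e → Solvable n (suc k′) t r C → 2 ^ e * t ≤ Φ C
  Solvable⇒Φ-≥ {t} {C} 0<e (C′ , C⇒C′ , t≤C′r) = begin
    2 ^ e * t                  ≤⟨ *-monoʳ-≤ (2 ^ e) t≤C′r ⟩
    2 ^ e * C′ r               ≡⟨ weight-root 0<e (C′ r) ⟨
    weight 0 (C′ r)            ≡⟨ cong (λ L → weight L (C′ r)) level-root ⟨
    weight (level r) (C′ r)    ≤⟨ ≤∑ (λ x → weight (level x) (C′ x)) r ⟩
    Φ C′                       ≤⟨ Φ-star C⇒C′ ⟩
    Φ C                        ∎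
    where open ≤-Reasoning

  Far : Fin n → Set
  Far x = e ≤ level x

  farIndicator : Vector ℕ n
  farIndicator x with e ≤? level x
  ... | yes _ = 1
  ... | no _  = 0

  farIndicator-Far : ∀ {x} → Far x → farIndicator x ≡ 1
  farIndicator-Far {x} far with e ≤? level x
  ... | yes _   = refl
  ... | no near = ⊥-elim (near far)

  farIndicator-pos⇒Far : ∀ {x} → 0 < farIndicator x → Far x
  farIndicator-pos⇒Far {x} pos with e ≤? level x
  ... | yes far = far
  ... | no _    = ⊥-elim (<-irrefl refl pos)

  weight-farIndicator : ∀ x → weight (level x) (farIndicator x) ≡ 0
  weight-farIndicator x with e ≤? level x
  ... | yes _ = refl
  ... | no _  = *-zeroʳ (2 ^ (e ∸ level x))

  nFar : ℕ
  nFar = ∑ farIndicator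

  nFar-≥-range : ∀ lo hi → hi ≤ n → (∀ x → lo ≤ toℕ x → toℕ x < hi → Far x) → hi ∸ lo ≤ nFar
  nFar-≥-range lo hi hi≤n far =
    ∑-≥-range farIndicator lo hi hi≤n λ x lo≤x x<hi → ≤-reflexive (sym (farIndicator-Far (far x lo≤x x<hi)))

  nFar-≥-allButRoot : (∀ x → x ≢ r → Far x) → n ∸ 1 ≤ nFar
  nFar-≥-allButRoot far = ∑-≥-allBut farIndicator r λ x x≢r → ≤-reflexive (sym (farIndicator-Far (far x x≢r)))

  spiked : Fin n → ℕ → Config n
  spiked z s x = farIndicator x + updateAt (λ _ → 0) z (λ _ → s) x

  size-spiked : ∀ z s → ∑ (spiked z s) ≡ nFar + s
  size-spiked z s =
    trans (∑-distrib-+ farIndicator _)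
          (cong (nFar +_) (trans (∑-single _ z λ x x≢z → updateAt-minimal x z _ x≢z) (updateAt-updates z _)))

  Φ-spiked : ∀ z s → Far z → Φ (spiked z s) ≤ suc s
  Φ-spiked z s far = begin
    Φ (spiked z s)                    ≡⟨ ∑-single _ z weight-off-z ⟩
    weight (level z) (spiked z s z)   ≤⟨ weight-Far (spiked z s z) ⟩
    spiked z s z                      ≡⟨ cong₂ _+_ (farIndicator-Far far) (updateAt-updates z _) ⟩
    suc s                             ∎
    where
    open ≤-Reasoning
    weight-off-z : ∀ x → x ≢ z → weight (level x) (spiked z s x) ≡ 0
    weight-off-z x x≢z = trans (cong (weight (level x))
                                     (trans (cong (farIndicator x +_) (updateAt-minimal x z _ x≢z))
                                            (+-identityʳ (farIndicator x))))
                               (weight-farIndicator x)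
    weight-Far : ∀ c → weight (level z) c ≤ c
    weight-Far c with e ≤? level z
    ... | yes _   = evenFloor-≤ c
    ... | no near = ⊥-elim (near far)

  unsolvable : ∀ {t c m} → 0 < e → 0 < t → 0 < c → c ≤ nFar → m + 2 ≤ c + 2 ^ e * t
             → Σ (Config n) λ C → size C ≡ m × ¬ Solvable n (suc k′) t r C
  unsolvable {t} {c} {m} 0<e 0<t 0<c c≤nFar m+2≤ =
    C , trans (size≡∑ C) (proj₂ (proj₂ shrunk)) , λ solvable → <⇒≱ Φ-C<T (Solvable⇒Φ-≥ 0<e solvable)
    where
    T = 2 ^ e * t
    2≤T : 2 ≤ T
    2≤T = *-mono-≤ (^-monoʳ-≤ 2 0<e) 0<t
    farVertex = ∑-pos⇒∃-pos farIndicator (≤-trans 0<c c≤nFar)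
    z = proj₁ farVertex
    D = spiked z (T ∸ 2)
    m≤∑D : m ≤ ∑ D
    m≤∑D = +-cancelʳ-≤ 2 m _ (begin
      m + 2                  ≤⟨ m+2≤ ⟩
      c + T                  ≤⟨ +-monoˡ-≤ T c≤nFar ⟩
      nFar + T               ≡⟨ cong (nFar +_) (m∸n+n≡m 2≤T) ⟨
      nFar + (T ∸ 2 + 2)     ≡⟨ +-assoc nFar (T ∸ 2) 2 ⟨
      nFar + (T ∸ 2) + 2     ≡⟨ cong (_+ 2) (size-spiked z (T ∸ 2)) ⟨
      ∑ D + 2                ∎)
      where open ≤-Reasoning
    shrunk = ∑-shrink D m m≤∑D
    C = proj₁ shrunk
    Φ-C<T : Φ C < T
    Φ-C<T = begin-strict
      Φ C            ≤⟨ Φ-mono-≤ (proj₁ (proj₂ shrunk)) ⟩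
      Φ D            ≤⟨ Φ-spiked z (T ∸ 2) (farIndicator-pos⇒Far (proj₂ farVertex)) ⟩
      suc (T ∸ 2)    <⟨ ≤-reflexive (m+[n∸m]≡n 2≤T) ⟩
      T              ∎
      where open ≤-Reasoning

Adj-of-∣-∣ : ∀ {n k d} (x y : Fin n) → ∣ toℕ x - toℕ y ∣ ≡ d → 1 ≤ d → d ≤ k → Adj n k x y
Adj-of-∣-∣ x y refl 1≤d d≤k = 1≤d , d≤k

-- The two neighbours of r are a = r − p and a + (p + q) = r + q.
¬Simplicial-spread : ∀ {n k} (r : Fin n) a p q → a + p ≡ toℕ r → a + (p + q) < n
                   → 1 ≤ p → p ≤ k → 1 ≤ q → q ≤ k → k < p + q → ¬ Simplicial n k r
¬Simplicial-spread r a p q a+p≡r w<n 1≤p p≤k 1≤q q≤k k<p+q simp =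
  <⇒≱ k<p+q (subst (_≤ _) ∣u-w∣ (proj₂ (simp u w r~u r~w u≢w)))
  where
  u = fromℕ< (≤-<-trans (m≤m+n a (p + q)) w<n)
  w = fromℕ< w<n
  ∣r-u∣ : ∣ toℕ r - toℕ u ∣ ≡ p
  ∣r-u∣ rewrite toℕ-fromℕ< (≤-<-trans (m≤m+n a (p + q)) w<n) | sym a+p≡r =
    trans (∣-∣-comm (a + p) a) (∣m-m+n∣≡n a p)
  ∣r-w∣ : ∣ toℕ r - toℕ w ∣ ≡ q
  ∣r-w∣ rewrite toℕ-fromℕ< w<n | sym a+p≡r | sym (+-assoc a p q) = ∣m-m+n∣≡n (a + p) q
  ∣u-w∣ : ∣ toℕ u - toℕ w ∣ ≡ p + q
  ∣u-w∣ rewrite toℕ-fromℕ< w<n | toℕ-fromℕ< (≤-<-trans (m≤m+n a (p + q)) w<n) = ∣m-m+n∣≡n a (p + q)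
  r~u = Adj-of-∣-∣ r u ∣r-u∣ 1≤p p≤k
  r~w = Adj-of-∣-∣ r w ∣r-w∣ 1≤q q≤k
  u≢w : u ≢ w
  u≢w u≡w = <⇒≢ (≤-trans 1≤p (m≤m+n p q))
                 (trans (sym (∣n-n∣≡0 (toℕ u))) (trans (cong (λ x → ∣ toℕ u - toℕ x ∣) u≡w) ∣u-w∣))

<-⊓-+ : ∀ {i j k} → 1 ≤ i → 1 ≤ j → 1 ≤ k → k < i + j → k < i ⊓ k + j ⊓ k
<-⊓-+ {i} {j} {k} 1≤i 1≤j 1≤k k<i+j with ≤-total i k | ≤-total j k
... | inj₂ k≤i | _        rewrite m≥n⇒m⊓n≡n k≤i =
  ≤-trans (≤-reflexive (+-comm 1 k)) (+-monoʳ-≤ k (⊓-glb 1≤j 1≤k))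
... | inj₁ i≤k | inj₂ k≤j rewrite m≥n⇒m⊓n≡n k≤j | +-comm (i ⊓ k) k =
  ≤-trans (≤-reflexive (+-comm 1 k)) (+-monoʳ-≤ k (⊓-glb 1≤i 1≤k))
... | inj₁ i≤k | inj₁ j≤k rewrite m≤n⇒m⊓n≡m i≤k | m≤n⇒m⊓n≡m j≤k = k<i+j

Simplicial-position : ∀ {n′ k′} (r : Fin (2 + n′)) → Simplicial (2 + n′) (suc k′) r
                    → toℕ r ≡ 0 ⊎ toℕ r ≡ suc n′ ⊎ n′ < suc k′
Simplicial-position {n′} {k′} r simp with toℕ r ≟ℕ 0 | toℕ r ≟ℕ suc n′ | n′ <? suc k′
... | yes r≡0 | _         | _        = inj₁ r≡0
... | no _    | yes r≡end | _        = inj₂ (inj₁ r≡end)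
... | no _    | no _      | yes n′<k = inj₂ (inj₂ n′<k)
... | no r≢0  | no r≢end  | no n′≮k  = ⊥-elim (¬Simplicial-spread r (i ∸ p) p q (m∸n+n≡m (m⊓n≤m i K)) w<n
                                          (⊓-glb 1≤i z<s) (m⊓n≤n i K) (⊓-glb 1≤j z<s) (m⊓n≤n j K)
                                          (<-⊓-+ 1≤i 1≤j z<s K<i+j) simp)
  where
  K = suc k′
  i = toℕ r
  j = suc n′ ∸ i
  p = i ⊓ K
  q = j ⊓ K
  1≤i : 1 ≤ i
  1≤i = n≢0⇒n>0 r≢0
  i<end : i < suc n′
  i<end = ≤∧≢⇒< (s≤s⁻¹ (toℕ<n r)) r≢end
  1≤j : 1 ≤ j
  1≤j = m<n⇒0<n∸m i<end
  i+j≡end : i + j ≡ suc n′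
  i+j≡end = m+[n∸m]≡n (<⇒≤ i<end)
  K<i+j : K < i + j
  K<i+j = subst (K <_) (sym i+j≡end) (s≤s (≮⇒≥ n′≮k))
  w<n : i ∸ p + (p + q) < 2 + n′
  w<n = begin-strict
    i ∸ p + (p + q)   ≡⟨ +-assoc (i ∸ p) p q ⟨
    i ∸ p + p + q     ≡⟨ cong (_+ q) (m∸n+n≡m (m⊓n≤m i K)) ⟩
    i + q             ≤⟨ +-monoʳ-≤ i (m⊓n≤m j K) ⟩
    i + j             ≡⟨ i+j≡end ⟩
    suc n′            <⟨ n<1+n (suc n′) ⟩
    2 + n′            ∎
    where open ≤-Reasoning

module _ {n′ k′ : ℕ} (r : Fin (2 + n′)) where
  private
    open Potential k′ r (suc (n′ / suc k′))
    K = suc k′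
    q = n′ / K
    qK≤n′ : q * K ≤ n′
    qK≤n′ = m/n*n≤m n′ K

  nFar-≥-endpoint : toℕ r ≡ 0 ⊎ toℕ r ≡ suc n′ → suc (n′ ∸ q * K) ≤ nFar
  nFar-≥-endpoint (inj₁ r≡0) =
    subst (_≤ nFar) (+-∸-assoc 1 qK≤n′) (nFar-≥-range (suc (q * K)) (2 + n′) ≤-refl far)
    where
    far : ∀ x → suc (q * K) ≤ toℕ x → toℕ x < 2 + n′ → Far x
    far x qK<x _ rewrite r≡0 | ∣-∣-identityʳ (toℕ x) = <⌈/⌉ k′ q qK<x
  nFar-≥-endpoint (inj₂ r≡end) = nFar-≥-range 0 (suc (n′ ∸ q * K)) (s≤s b≤1+n′) far
    where
    b≤1+n′ : n′ ∸ q * K ≤ suc n′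
    b≤1+n′ = ≤-trans (m∸n≤m n′ (q * K)) (n≤1+n n′)
    far : ∀ x → 0 ≤ toℕ x → toℕ x < suc (n′ ∸ q * K) → Far x
    far x _ (s≤s x≤b) rewrite r≡end | m≤n⇒∣m-n∣≡n∸m (≤-trans x≤b b≤1+n′) =
      <⌈/⌉ k′ q (m+n≤o⇒m≤o∸n (suc (q * K)) (s≤s (≤-trans (≤-reflexive (+-comm (q * K) (toℕ x)))
                                                           (m≤o∸n⇒m+n≤o (toℕ x) qK≤n′ x≤b))))

nFar-≥-simplicial : ∀ {n′ k′} (r : Fin (2 + n′)) → Simplicial (2 + n′) (suc k′) r
                  → suc (n′ ∸ n′ / suc k′ * suc k′) ≤ Potential.nFar k′ r (suc (n′ / suc k′))
nFar-≥-simplicial {n′} {k′} r simp with Simplicial-position r simp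
... | inj₁ r≡0            = nFar-≥-endpoint r (inj₁ r≡0)
... | inj₂ (inj₁ r≡end)   = nFar-≥-endpoint r (inj₂ r≡end)
... | inj₂ (inj₂ n′<K) rewrite m<n⇒m/n≡0 n′<K =
  Potential.nFar-≥-allButRoot k′ r 1 (λ x x≢r → <⌈/⌉ k′ 0 (≢⇒0<∣-∣ x≢r))

m<n+o⇒m+2≤1+o+n : ∀ {m n o} → m < n + o → m + 2 ≤ suc o + n
m<n+o⇒m+2≤1+o+n {m} {n} {o} m<n+o =
  ≤-trans (≤-reflexive (+-comm m 2)) (s≤s (≤-trans m<n+o (≤-reflexive (+-comm n o))))

lemma31 : (n k t : ℕ) → .{{_ : NonZero k}} → 2 ≤ n → 1 ≤ t → (r : Fin n) → Simplicial n k r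
          → (m : ℕ) → ((C : Config n) → size C ≡ m → Solvable n k t r C) → pt n k t ≤ m
lemma31 (suc (suc n′)) (suc k′) t (s≤s (s≤s z≤n)) 0<t r simp m allSolvable =
  ⊔-lub (≮⇒≥ (refute ∘ below-exponential)) (≮⇒≥ (refute ∘ below-linear))
  where
  K = suc k′
  q = n′ / K
  Unsolvable = Σ (Config (2 + n′)) λ C → size C ≡ m × ¬ Solvable (2 + n′) K t r C
  refute : Unsolvable → ⊥
  refute (C , size≡m , ¬solvable) = ¬solvable (allSolvable C size≡m)
  below-linear : m < 2 * t + (2 + n′) ∸ 2 → Unsolvable
  below-linear m<2t+n∸2 = Potential.unsolvable k′ r 1 z<s 0<t z<s
    (Potential.nFar-≥-allButRoot k′ r 1 (λ x x≢r → <⌈/⌉ k′ 0 (≢⇒0<∣-∣ x≢r)))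
    (m<n+o⇒m+2≤1+o+n {n = 2 * t} (subst (m <_) (+-∸-assoc (2 * t) (s≤s (s≤s z≤n))) m<2t+n∸2))
  b≡ : bb (2 + n′) K ≡ n′ ∸ q * K
  b≡ = cong (n′ ∸_) (trans (cong (K *_) (m+n∸n≡m q 1)) (*-comm K q))
  t2^d≡ : t * 2 ^ dd (2 + n′) K ≡ 2 ^ suc q * t
  t2^d≡ = trans (*-comm t _) (cong (λ d → 2 ^ d * t) (+-comm q 1))
  below-exponential : m < t * 2 ^ dd (2 + n′) K + bb (2 + n′) K → Unsolvable
  below-exponential m<t2^d+b = Potential.unsolvable k′ r (suc q) z<s 0<t z<s (nFar-≥-simplicial r simp)
    (m<n+o⇒m+2≤1+o+n {n = 2 ^ suc q * t} (subst₂ (λ a b → m < a + b) t2^d≡ b≡ m<t2^d+b))
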